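{- For all integers $n\geq 4$ and $k$ with $\lceil \frac{n}{2} \rceil \leq k \leq n-2$, there exists a tree $T$ on $n$ vertices with no pair of false-twin vertices that has exactly $k$ bicliques.
   Context: A biclique of a graph is a maximal (with respect to vertex-set inclusion) induced subgraph that is a complete bipartite graph $K_{p,q}$ with $p,q\geq 1$; bicliques are counted as distinct vertex sets. Two distinct vertices $u,v$ are false-twins if $N(u)=N(v)$, where $N(\cdot)$ denotes the open neighborhood. -}

module Defs where

open import Data.Nat using (ℕ; zero; suc; _≤_)
open import Data.Bool using (Bool; true; false)
open import Data.Fin using (Fin)
open import Data.Fin.Subset using (Subset; _∈_; _∉_; _⊆_)
open import Data.List using (List; []; _∷_; length)
open import Data.List.Relation.Unary.Unique.Propositional using (Unique)
open import Data.List.Membership.Propositional using () renaming (_∈_ to _∈ₗ_)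
open import Data.Product using (Σ; ∃; ∃-syntax; _×_; _,_)
open import Data.Sum using (_⊎_)
open import Data.Empty using (⊥)
open import Data.Unit using (⊤)
open import Relation.Nullary using (¬_)
open import Relation.Binary.PropositionalEquality using (_≡_; _≢_)
open import Function.Bundles using (_⇔_)

record Graph (n : ℕ) : Set where
  field
    adj     : Fin n → Fin n → Bool
    symm    : ∀ u v → adj u v ≡ adj v u
    irrefl  : ∀ u → adj u u ≡ false

open Graph public

Adj : ∀ {n} → Graph n → Fin n → Fin n → Set
Adj G u v = adj G u v ≡ true

data Walk {n : ℕ} (G : Graph n) : Fin n → Fin n → Set where
  here  : ∀ {u} → Walk G u u
  step  : ∀ {u w v} → Adj G u w → Walk G w v → Walk G u v

Connected : ∀ {n} → Graph n → Set
Connected G = ∀ u v → Walk G u v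

Chain : ∀ {n} → Graph n → List (Fin n) → Set
Chain G []           = ⊤
Chain G (x ∷ [])     = ⊤
Chain G (x ∷ y ∷ xs) = Adj G x y × Chain G (y ∷ xs)

last : ∀ {n} → Fin n → List (Fin n) → Fin n
last x []       = x
last x (y ∷ ys) = last y ys

-- A cycle: distinct vertices v₀,…,v_{m-1}, m ≥ 3, consecutive ones adjacent
-- and v_{m-1} adjacent to v₀.
IsCycle : ∀ {n} → Graph n → Fin n → List (Fin n) → Set
IsCycle G v vs = Unique (v ∷ vs) × 2 ≤ length vs × Chain G (v ∷ vs) × Adj G (last v vs) v

Acyclic : ∀ {n} → Graph n → Set
Acyclic G = ∀ v vs → ¬ IsCycle G v vs

IsTree : ∀ {n} → Graph n → Set
IsTree G = Connected G × Acyclic G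

FalseTwins : ∀ {n} → Graph n → Fin n → Fin n → Set
FalseTwins G u v = u ≢ v × (∀ w → Adj G u w ⇔ Adj G v w)

NoFalseTwins : ∀ {n} → Graph n → Set
NoFalseTwins G = ∀ u v → ¬ FalseTwins G u v

IsCompleteBipartite : ∀ {n} → Graph n → Subset n → Set
IsCompleteBipartite {n} G S =
  Σ (Subset n) λ A →
    A ⊆ S
    × (∃[ a ] a ∈ A)
    × (∃[ b ] (b ∈ S × b ∉ A))
    × (∀ u v → u ∈ S → v ∈ S →
         Adj G u v ⇔ ((u ∈ A × v ∉ A) ⊎ (u ∉ A × v ∈ A)))

IsBiclique : ∀ {n} → Graph n → Subset n → Set
IsBiclique G S =
  IsCompleteBipartite G S × (∀ S′ → S ⊆ S′ → IsCompleteBipartite G S′ → S′ ≡ S)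

HasExactlyBicliques : ∀ {n} → Graph n → ℕ → Set
HasExactlyBicliques {n} G k =
  Σ (List (Subset n)) λ L →
    Unique L × (∀ S → S ∈ₗ L ⇔ IsBiclique G S) × length L ≡ k

-- In a tree every induced complete bipartite subgraph is a star (K_{p,q} with p, q ≥ 2 contains a
-- 4-cycle) and every closed neighbourhood N[c] induces one, so the bicliques are the N[c] of the
-- vertices c of degree ≥ 2, as long as no edge joins two leaves.
-- A vertex of degree ≥ 2 has no false twin, since two common neighbours would close a 4-cycle,
-- and two leaves are false twins exactly when they share their neighbour. So it suffices to
-- find a tree with exactly k vertices of degree ≥ 2 whose leaves hang from distinct vertices:
-- the path 0 − 1 − ⋯ − k+1 with a pendant vertex k + a attached to a = 2, …, n − k − 1,
-- where n ≤ 2k keeps these a below k.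

module Submission where

open import Defs
open import Data.Bool using (true; false)
import Data.Bool.Properties as Bool
open import Data.Empty using (⊥; ⊥-elim)
open import Data.Fin using (Fin; toℕ; fromℕ<)
open import Data.Fin.Properties using (toℕ-injective; toℕ<n; toℕ-fromℕ<; any?)
  renaming (_≟_ to _≟ᶠ_)
open import Data.Fin.Subset using (Subset; _∈_; _∉_; _⊆_; ⁅_⁆; _∪_)
open import Data.Fin.Subset.Properties using (x∈⁅x⁆; x∈⁅y⁆⇒x≡y; x∈p∪q⁺; x∈p∪q⁻; ⊆-antisym; _∈?_)
open import Data.List as List using (List; []; _∷_; _++_)
open import Data.List.Membership.Propositional using () renaming (_∈_ to _∈ₗ_)
open import Data.List.Membership.Propositional.Properties using (∈-tabulate⁺; ∈-tabulate⁻)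
open import Data.List.Properties using (length-tabulate)
open import Data.List.Relation.Unary.All using (All; []; _∷_)
open import Data.List.Relation.Unary.AllPairs using (AllPairs; []; _∷_)
open import Data.List.Relation.Unary.Unique.Propositional.Properties using (tabulate⁺)
open import Data.Nat using (ℕ; zero; suc; _+_; _≤_; _<_; _∸_; z≤n; s≤s; ⌈_/2⌉)
open import Data.Nat.Properties
open import Data.Product using (Σ; ∃; _×_; _,_; proj₁; proj₂)
open import Data.Sum using (_⊎_; inj₁; inj₂; swap)
open import Data.Unit using (⊤; tt)
open import Data.Vec using (lookup; tabulate)
open import Data.Vec.Properties using (lookup∘tabulate; lookup⇒[]=; []=⇒lookup)
open import Function.Bundles using (_⇔_; mk⇔; Equivalence)
open import Function.Definitions using (Injective)
open import Relation.Binary using (tri<; tri≈; tri>)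
open import Relation.Binary.PropositionalEquality
open import Relation.Nullary using (¬_; Dec; yes; no; does)
open import Relation.Nullary.Decidable using (_×-dec_; _⊎-dec_; ¬?; dec-true; dec-false; does-⇔)

module GraphProperties {n : ℕ} (G : Graph n) where

  Adj-sym : ∀ {u v} → Adj G u v → Adj G v u
  Adj-sym {u} {v} uv = trans (symm G v u) uv

  Adj⇒≢ : ∀ {u v} → Adj G u v → u ≢ v
  Adj⇒≢ {u} uv refl with trans (sym uv) (irrefl G u)
  ... | ()

  Adj? : ∀ u v → Dec (Adj G u v)
  Adj? u v = adj G u v Bool.≟ true

  _◅◅_ : ∀ {u v w} → Walk G u v → Walk G v w → Walk G u w
  here      ◅◅ q = q
  step uw p ◅◅ q = step uw (p ◅◅ q)

  reverse : ∀ {u v} → Walk G u v → Walk G v u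
  reverse here        = here
  reverse (step uw p) = reverse p ◅◅ step (Adj-sym uw) here

  LowerNeighbour : Fin n → Fin n → Set
  LowerNeighbour v u = Adj G v u × toℕ u < toℕ v

  connected-if-lowerNeighbours : (∀ v → 0 < toℕ v → ∃ (LowerNeighbour v)) → Connected G
  connected-if-lowerNeighbours lower u v = descend u ≤-refl ◅◅ reverse (descend v ≤-refl)
    where
    root : Fin n
    root = fromℕ< (≤-trans (s≤s z≤n) (toℕ<n u))

    descend : ∀ {m} w → toℕ w ≤ m → Walk G w root
    descend w w≤m with toℕ w ≟ 0
    ... | yes w≡0 = subst (Walk G w) (toℕ-injective (trans w≡0 (sym (toℕ-fromℕ< _)))) here
    descend {zero}  w w≤0   | no w≢0 = ⊥-elim (w≢0 (n≤0⇒n≡0 w≤0))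
    descend {suc m} w w≤1+m | no w≢0 with lower w (n≢0⇒n>0 w≢0)
    ... | x , wx , x<w = step wx (descend x (≤-pred (≤-trans x<w w≤1+m)))

  -- No vertex of a non-backtracking walk has both walk-neighbours below it, so a walk that once
  -- climbs keeps climbing and one that ends by descending descended all along; a cycle through v
  -- can neither climb from v, nor descend into v, nor have v as a peak.
  module UniqueLowerNeighbours
    (unique : ∀ {v u w} → LowerNeighbour v u → LowerNeighbour v w → u ≡ w) where

    NonBacktracking : List (Fin n) → Set
    NonBacktracking (x ∷ y ∷ z ∷ r) = x ≢ z × NonBacktracking (y ∷ z ∷ r)
    NonBacktracking _               = ⊤

    EndsDescending : List (Fin n) → Set
    EndsDescending (x ∷ y ∷ [])    = toℕ y < toℕ x
    EndsDescending (x ∷ y ∷ z ∷ r) = EndsDescending (y ∷ z ∷ r)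
    EndsDescending _               = ⊥

    no-peak : ∀ {a b c} → Adj G a b → Adj G b c → toℕ a < toℕ b → toℕ c < toℕ b → a ≡ c
    no-peak ab bc a<b c<b = unique (Adj-sym ab , a<b) (bc , c<b)

    ascending-stays-ascending : ∀ a b r → Chain G (a ∷ b ∷ r) → NonBacktracking (a ∷ b ∷ r) →
                                toℕ a < toℕ b → toℕ a < toℕ (last b r)
    ascending-stays-ascending a b []      _              _          a<b = a<b
    ascending-stays-ascending a b (c ∷ r) (ab , bc , ch) (a≢c , nb) a<b with <-cmp (toℕ b) (toℕ c)
    ... | tri< b<c _ _ = <-trans a<b (ascending-stays-ascending b c r (bc , ch) nb b<c)
    ... | tri≈ _ b≡c _ = ⊥-elim (Adj⇒≢ bc (toℕ-injective b≡c))
    ... | tri> _ _ c<b = ⊥-elim (a≢c (no-peak ab bc a<b c<b))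

    descending-throughout : ∀ a b r → Chain G (a ∷ b ∷ r) → NonBacktracking (a ∷ b ∷ r) →
                            EndsDescending (a ∷ b ∷ r) → toℕ b < toℕ a × toℕ (last b r) < toℕ a
    descending-throughout a b []      _              _          b<a = b<a , b<a
    descending-throughout a b (c ∷ r) (ab , bc , ch) (a≢c , nb) end
      with descending-throughout b c r (bc , ch) nb end
    ... | c<b , l<b with <-cmp (toℕ a) (toℕ b)
    ... | tri< a<b _ _ = ⊥-elim (a≢c (no-peak ab bc a<b c<b))
    ... | tri≈ _ a≡b _ = ⊥-elim (Adj⇒≢ ab (toℕ-injective a≡b))
    ... | tri> _ _ b<a = b<a , <-trans l<b b<a

    last-snoc : ∀ (x : Fin n) xs v → last x (xs ++ v ∷ []) ≡ v
    last-snoc x []       v = refl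
    last-snoc x (y ∷ ys) v = last-snoc y ys v

    chain-snoc : ∀ x xs v → Chain G (x ∷ xs) → Adj G (last x xs) v → Chain G (x ∷ xs ++ v ∷ [])
    chain-snoc x []       v _         lv = lv , tt
    chain-snoc x (y ∷ ys) v (xy , ch) lv = xy , chain-snoc y ys v ch lv

    endsDescending-snoc : ∀ x xs v → toℕ v < toℕ (last x xs) → EndsDescending (x ∷ xs ++ v ∷ [])
    endsDescending-snoc x []           v v<l = v<l
    endsDescending-snoc x (y ∷ [])     v v<l = v<l
    endsDescending-snoc x (y ∷ z ∷ zs) v v<l = endsDescending-snoc y (z ∷ zs) v v<l

    nonBacktracking-snoc : ∀ x y z r v → AllPairs _≢_ (x ∷ y ∷ z ∷ r) → All (v ≢_) (y ∷ z ∷ r) →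
                           NonBacktracking (x ∷ y ∷ z ∷ r ++ v ∷ [])
    nonBacktracking-snoc x y z []      v ((_ ∷ x≢z ∷ _) ∷ _) (v≢y ∷ _) = x≢z , (λ y≡v → v≢y (sym y≡v)) , tt
    nonBacktracking-snoc x y z (w ∷ r) v ((_ ∷ x≢z ∷ _) ∷ u) (_ ∷ vs)  = x≢z , nonBacktracking-snoc y z w r v u vs

    all-last : ∀ {P : Fin n → Set} z r → All P (z ∷ r) → P (last z r)
    all-last z []      (pz ∷ [])  = pz
    all-last z (w ∷ r) (_  ∷ ps) = all-last w r ps

    acyclic : Acyclic G
    acyclic v []          (_ , () , _)
    acyclic v (y ∷ [])    (_ , s≤s () , _)
    acyclic v (y ∷ z ∷ r) (distinct@(v∉ ∷ y∉ ∷ _) , _ , ch , lv) =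
      no-closed-walk (chain-snoc v (y ∷ z ∷ r) v ch lv) (nonBacktracking-snoc v y z r v distinct v∉)
      where
      closing : last y (z ∷ r ++ v ∷ []) ≡ v
      closing = last-snoc y (z ∷ r) v

      no-closed-walk : Chain G (v ∷ y ∷ z ∷ r ++ v ∷ []) → NonBacktracking (v ∷ y ∷ z ∷ r ++ v ∷ []) → ⊥
      no-closed-walk closed nb with <-cmp (toℕ v) (toℕ y)
      ... | tri< v<y _ _ =
            <-irrefl (cong toℕ (sym closing)) (ascending-stays-ascending v y (z ∷ r ++ v ∷ []) closed nb v<y)
      ... | tri≈ _ v≡y _ = Adj⇒≢ (proj₁ ch) (toℕ-injective v≡y)
      ... | tri> _ _ y<v with <-cmp (toℕ v) (toℕ (last z r))
      ...   | tri< v<l _ _ = <-irrefl (cong toℕ closing)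
              (proj₂ (descending-throughout v y (z ∷ r ++ v ∷ []) closed nb
                        (endsDescending-snoc v (y ∷ z ∷ r) v v<l)))
      ...   | tri≈ _ v≡l _ = Adj⇒≢ lv (toℕ-injective (sym v≡l))
      ...   | tri> _ _ l<v = all-last z r y∉ (no-peak (Adj-sym (proj₁ ch)) (Adj-sym lv) y<v l<v)

module Bicliques {n : ℕ} (G : Graph n) (acyclic : Acyclic G) where
  open GraphProperties G

  no-triangle : ∀ {x y z} → Adj G x y → Adj G y z → Adj G z x → ⊥
  no-triangle {x} {y} {z} xy yz zx =
    acyclic x (y ∷ z ∷ [])
      ( ((Adj⇒≢ xy ∷ (λ x≡z → Adj⇒≢ zx (sym x≡z)) ∷ []) ∷ (Adj⇒≢ yz ∷ []) ∷ [] ∷ [])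
      , s≤s (s≤s z≤n) , (xy , yz , tt) , zx)

  no-square : ∀ {x y z w} → Adj G x y → Adj G y z → Adj G z w → Adj G w x → x ≢ z → y ≢ w → ⊥
  no-square {x} {y} {z} {w} xy yz zw wx x≢z y≢w =
    acyclic x (y ∷ z ∷ w ∷ [])
      ( ((Adj⇒≢ xy ∷ x≢z ∷ (λ x≡w → Adj⇒≢ wx (sym x≡w)) ∷ []) ∷ (Adj⇒≢ yz ∷ y≢w ∷ []) ∷ (Adj⇒≢ zw ∷ []) ∷ [] ∷ [])
      , s≤s (s≤s z≤n) , (xy , yz , zw , tt) , wx)

  nbhd : Fin n → Subset n
  nbhd c = tabulate (adj G c)

  ∈nbhd⇔Adj : ∀ {c x} → x ∈ nbhd c ⇔ Adj G c x
  ∈nbhd⇔Adj {c} {x} = mk⇔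
    (λ x∈ → trans (sym (lookup∘tabulate (adj G c) x)) ([]=⇒lookup x∈))
    (λ cx → lookup⇒[]= x (nbhd c) (trans (lookup∘tabulate (adj G c) x) cx))

  N[_] : Fin n → Subset n
  N[ c ] = ⁅ c ⁆ ∪ nbhd c

  ∈N[]⁺ : ∀ {c x} → x ≡ c ⊎ Adj G c x → x ∈ N[ c ]
  ∈N[]⁺ (inj₁ refl) = x∈p∪q⁺ (inj₁ (x∈⁅x⁆ _))
  ∈N[]⁺ (inj₂ cx)   = x∈p∪q⁺ (inj₂ (Equivalence.from ∈nbhd⇔Adj cx))

  ∈N[]⁻ : ∀ {c x} → x ∈ N[ c ] → x ≡ c ⊎ Adj G c x
  ∈N[]⁻ {c} x∈ with x∈p∪q⁻ ⁅ c ⁆ (nbhd c) x∈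
  ... | inj₁ x∈⁅c⁆ = inj₁ (x∈⁅y⁆⇒x≡y c x∈⁅c⁆)
  ... | inj₂ x∈nbhd = inj₂ (Equivalence.to ∈nbhd⇔Adj x∈nbhd)

  ∈N[]-≢⇒Adj : ∀ {c x} → x ∈ N[ c ] → x ≢ c → Adj G c x
  ∈N[]-≢⇒Adj x∈ x≢c with ∈N[]⁻ x∈
  ... | inj₁ x≡c = ⊥-elim (x≢c x≡c)
  ... | inj₂ cx  = cx

  Bipartition : Subset n → Subset n → Set
  Bipartition S A = ∀ u v → u ∈ S → v ∈ S → Adj G u v ⇔ ((u ∈ A × v ∉ A) ⊎ (u ∉ A × v ∈ A))

  lookup≡false⇒∉ : ∀ {A : Subset n} {x} → lookup A x ≡ false → x ∉ A
  lookup≡false⇒∉ x∉ x∈ with trans (sym ([]=⇒lookup x∈)) x∉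
  ... | ()

  Adj⇒sides-differ : ∀ {S A u v} → Bipartition S A → u ∈ S → v ∈ S → Adj G u v → lookup A u ≢ lookup A v
  Adj⇒sides-differ {A = A} {u} {v} bip u∈S v∈S uv same with Equivalence.to (bip u v u∈S v∈S) uv
  ... | inj₁ (u∈A , v∉A) = v∉A (lookup⇒[]= v A (trans (sym same) ([]=⇒lookup u∈A)))
  ... | inj₂ (u∉A , v∈A) = u∉A (lookup⇒[]= u A (trans same ([]=⇒lookup v∈A)))

  sides-differ⇒Adj : ∀ {S A u v} → Bipartition S A → u ∈ S → v ∈ S → lookup A u ≢ lookup A v → Adj G u v
  sides-differ⇒Adj {A = A} {u} {v} bip u∈S v∈S differ
    with lookup A u in u-side | lookup A v in v-side
  ... | true  | true  = ⊥-elim (differ refl)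
  ... | false | false = ⊥-elim (differ refl)
  ... | true  | false = Equivalence.from (bip u v u∈S v∈S)
                          (inj₁ (lookup⇒[]= u A u-side , lookup≡false⇒∉ v-side))
  ... | false | true  = Equivalence.from (bip u v u∈S v∈S)
                          (inj₂ (lookup≡false⇒∉ u-side , lookup⇒[]= v A v-side))

  N[]-isCompleteBipartite : ∀ {c p} → Adj G c p → IsCompleteBipartite G N[ c ]
  N[]-isCompleteBipartite {c} {p} cp =
    ⁅ c ⁆ , (λ x∈⁅c⁆ → ∈N[]⁺ (inj₁ (x∈⁅y⁆⇒x≡y c x∈⁅c⁆))) , (c , x∈⁅x⁆ c)
    , (p , ∈N[]⁺ (inj₂ cp) , λ p∈⁅c⁆ → Adj⇒≢ cp (sym (x∈⁅y⁆⇒x≡y c p∈⁅c⁆))) , bipartition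
    where
    ∉⁅c⁆ : ∀ {x} → Adj G c x → x ∉ ⁅ c ⁆
    ∉⁅c⁆ cx x∈⁅c⁆ = Adj⇒≢ cx (sym (x∈⁅y⁆⇒x≡y c x∈⁅c⁆))

    bipartition : Bipartition N[ c ] ⁅ c ⁆
    bipartition u v u∈ v∈ = mk⇔ to from
      where
      to : Adj G u v → (u ∈ ⁅ c ⁆ × v ∉ ⁅ c ⁆) ⊎ (u ∉ ⁅ c ⁆ × v ∈ ⁅ c ⁆)
      to uv with ∈N[]⁻ u∈ | ∈N[]⁻ v∈
      ... | inj₁ refl | inj₁ refl = ⊥-elim (Adj⇒≢ uv refl)
      ... | inj₁ refl | inj₂ cv   = inj₁ (x∈⁅x⁆ c , ∉⁅c⁆ cv)
      ... | inj₂ cu   | inj₁ refl = inj₂ (∉⁅c⁆ cu , x∈⁅x⁆ c)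
      ... | inj₂ cu   | inj₂ cv   = ⊥-elim (no-triangle cu uv (Adj-sym cv))

      from : (u ∈ ⁅ c ⁆ × v ∉ ⁅ c ⁆) ⊎ (u ∉ ⁅ c ⁆ × v ∈ ⁅ c ⁆) → Adj G u v
      from (inj₁ (u∈⁅c⁆ , v∉⁅c⁆)) rewrite x∈⁅y⁆⇒x≡y c u∈⁅c⁆ =
        ∈N[]-≢⇒Adj v∈ λ v≡c → v∉⁅c⁆ (subst (_∈ ⁅ c ⁆) (sym v≡c) (x∈⁅x⁆ c))
      from (inj₂ (u∉⁅c⁆ , v∈⁅c⁆)) rewrite x∈⁅y⁆⇒x≡y c v∈⁅c⁆ =
        Adj-sym (∈N[]-≢⇒Adj u∈ λ u≡c → u∉⁅c⁆ (subst (_∈ ⁅ c ⁆) (sym u≡c) (x∈⁅x⁆ c)))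

  Branching : Fin n → Set
  Branching c = Σ (Fin n) λ a → Σ (Fin n) λ b → Adj G c a × Adj G c b × a ≢ b

  branching? : ∀ c → Dec (Branching c)
  branching? c = any? λ a → any? λ b → Adj? c a ×-dec Adj? c b ×-dec ¬? (a ≟ᶠ b)

  ¬branching⇒neighbours-equal : ∀ {c a b} → ¬ Branching c → Adj G c a → Adj G c b → a ≡ b
  ¬branching⇒neighbours-equal {a = a} {b} ¬br ca cb with a ≟ᶠ b
  ... | yes a≡b = a≡b
  ... | no  a≢b = ⊥-elim (¬br (a , b , ca , cb , a≢b))

  N[]-maximal : ∀ {c} → Branching c → ∀ S → N[ c ] ⊆ S → IsCompleteBipartite G S → S ≡ N[ c ]
  N[]-maximal {c} (a , b , ca , cb , a≢b) S N[c]⊆S (A , _ , _ , _ , bip) = ⊆-antisym S⊆N[c] N[c]⊆S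
    where
    c∈S : c ∈ S
    c∈S = N[c]⊆S (∈N[]⁺ (inj₁ refl))

    a∈S : a ∈ S
    a∈S = N[c]⊆S (∈N[]⁺ (inj₂ ca))

    b∈S : b ∈ S
    b∈S = N[c]⊆S (∈N[]⁺ (inj₂ cb))

    S⊆N[c] : S ⊆ N[ c ]
    S⊆N[c] {x} x∈S with x ≟ᶠ c | Adj? c x
    ... | yes x≡c | _      = ∈N[]⁺ (inj₁ x≡c)
    ... | no _    | yes cx = ∈N[]⁺ (inj₂ cx)
    ... | no x≢c  | no ¬cx = ⊥-elim (no-square (x~ a∈S ca) (Adj-sym ca) cb (Adj-sym (x~ b∈S cb)) x≢c a≢b)
      where
      -- x is not adjacent to c, so it lies on c's side and is adjacent to c's neighbours
      same-side : lookup A x ≡ lookup A c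
      same-side with lookup A x Bool.≟ lookup A c
      ... | yes same = same
      ... | no differ = ⊥-elim (¬cx (Adj-sym (sides-differ⇒Adj bip x∈S c∈S differ)))

      x~ : ∀ {y} → y ∈ S → Adj G c y → Adj G x y
      x~ y∈S cy = sides-differ⇒Adj bip x∈S y∈S
        (λ same → Adj⇒sides-differ bip c∈S y∈S cy (trans (sym same-side) same))

  N[]-isBiclique : ∀ {c} → Branching c → IsBiclique G N[ c ]
  N[]-isBiclique br@(_ , _ , ca , _) = N[]-isCompleteBipartite ca , N[]-maximal br

  biclique⇒N[] : ∀ {S} → IsBiclique G S → ∃ λ c → S ≡ N[ c ]
  biclique⇒N[] {S} ((A , A⊆S , (a , a∈A) , (b , b∈S , b∉A) , bip) , maximal) =
    centre (any? λ x → x ∈? S ×-dec x ∈? A ×-dec ¬? (x ≟ᶠ a))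
    where
    a∈S : a ∈ S
    a∈S = A⊆S a∈A

    ab : Adj G a b
    ab = Equivalence.from (bip a b a∈S b∈S) (inj₁ (a∈A , b∉A))

    centre : Dec (∃ λ x → x ∈ S × x ∈ A × x ≢ a) → ∃ λ c → S ≡ N[ c ]
    centre (yes (x , x∈S , x∈A , x≢a)) = b , sym (maximal N[ b ] S⊆N[b] (N[]-isCompleteBipartite (Adj-sym ab)))
      where
      -- a second vertex x on a's side leaves b alone on its side: else a b x y is a square
      S⊆N[b] : S ⊆ N[ b ]
      S⊆N[b] {y} y∈S with y ∈? A | y ≟ᶠ b
      ... | yes y∈A | _       = ∈N[]⁺ (inj₂ (Equivalence.from (bip b y b∈S y∈S) (inj₂ (b∉A , y∈A))))
      ... | no _    | yes y≡b = ∈N[]⁺ (inj₁ y≡b)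
      ... | no y∉A  | no y≢b  = ⊥-elim (no-square ab
              (Equivalence.from (bip b x b∈S x∈S) (inj₂ (b∉A , x∈A)))
              (Equivalence.from (bip x y x∈S y∈S) (inj₁ (x∈A , y∉A)))
              (Equivalence.from (bip y a y∈S a∈S) (inj₂ (y∉A , a∈A)))
              (λ a≡x → x≢a (sym a≡x)) (λ b≡y → y≢b (sym b≡y)))
    centre (no ¬x) = a , sym (maximal N[ a ] S⊆N[a] (N[]-isCompleteBipartite ab))
      where
      S⊆N[a] : S ⊆ N[ a ]
      S⊆N[a] {y} y∈S with y ∈? A | y ≟ᶠ a
      ... | no y∉A  | _       = ∈N[]⁺ (inj₂ (Equivalence.from (bip a y a∈S y∈S) (inj₁ (a∈A , y∉A))))
      ... | yes _   | yes y≡a = ∈N[]⁺ (inj₁ y≡a)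
      ... | yes y∈A | no y≢a  = ⊥-elim (¬x (y , y∈S , y∈A , y≢a))

  N[]-injective : ∀ {c d} → Branching c → N[ c ] ≡ N[ d ] → c ≡ d
  N[]-injective {c} {d} (a , b , ca , cb , a≢b) N[c]≡N[d] with c ≟ᶠ d
  ... | yes c≡d = c≡d
  ... | no  c≢d with other-neighbour
    where
    other-neighbour : Σ (Fin n) λ w → Adj G c w × w ≢ d
    other-neighbour with a ≟ᶠ d
    ... | yes a≡d = b , cb , λ b≡d → a≢b (trans a≡d (sym b≡d))
    ... | no  a≢d = a , ca , a≢d
  ... | w , cw , w≢d = ⊥-elim (no-triangle cw (Adj-sym (d~ (∈N[]⁺ (inj₂ cw)) w≢d)) (d~ (∈N[]⁺ (inj₁ refl)) c≢d))
    where
    d~ : ∀ {x} → x ∈ N[ c ] → x ≢ d → Adj G d x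
    d~ x∈ x≢d = ∈N[]-≢⇒Adj (subst (_ ∈_) N[c]≡N[d] x∈) x≢d

  branching⇒no-falseTwin : ∀ {u v} → Branching u → ¬ FalseTwins G u v
  branching⇒no-falseTwin (a , b , ua , ub , a≢b) (u≢v , same) =
    no-square ua (Adj-sym (Equivalence.to (same a) ua)) (Equivalence.to (same b) ub) (Adj-sym ub) u≢v a≢b

  falseTwins-sym : ∀ {u v} → FalseTwins G u v → FalseTwins G v u
  falseTwins-sym (u≢v , same) =
    (λ v≡u → u≢v (sym v≡u)) , λ w → mk⇔ (Equivalence.from (same w)) (Equivalence.to (same w))

  module NoIsolatedVerticesOrEdges
    (has-neighbour : ∀ c → ∃ (Adj G c))
    (leaf-neighbour-branching : ∀ {c p} → ¬ Branching c → Adj G c p → Branching p) where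

    biclique⇒N[branching] : ∀ {S} → IsBiclique G S → ∃ λ c → Branching c × S ≡ N[ c ]
    biclique⇒N[branching] biclique@(_ , maximal) with biclique⇒N[] biclique
    ... | c , refl with branching? c
    ...   | yes br = c , br , refl
    ...   | no ¬br with has-neighbour c
    ...     | p , cp = p , leaf-neighbour-branching ¬br cp
                     , sym (maximal N[ p ] N[c]⊆N[p] (N[]-isCompleteBipartite (Adj-sym cp)))
      where
      N[c]⊆N[p] : N[ c ] ⊆ N[ p ]
      N[c]⊆N[p] x∈ with ∈N[]⁻ x∈
      ... | inj₁ refl = ∈N[]⁺ (inj₂ (Adj-sym cp))
      ... | inj₂ cx   = ∈N[]⁺ (inj₁ (¬branching⇒neighbours-equal ¬br cx cp))

    exactly-bicliques : ∀ {k} (vertex : Fin k → Fin n) → Injective _≡_ _≡_ vertex →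
                        (∀ i → Branching (vertex i)) → (∀ c → Branching c → ∃ λ i → vertex i ≡ c) →
                        HasExactlyBicliques G k
    exactly-bicliques vertex injective branching onto =
      bicliques , tabulate⁺ (λ N≡N → injective (N[]-injective (branching _) N≡N))
      , (λ S → mk⇔ listed⇒biclique biclique⇒listed) , length-tabulate _
      where
      bicliques : List (Subset n)
      bicliques = List.tabulate (λ i → N[ vertex i ])

      listed⇒biclique : ∀ {S} → S ∈ₗ bicliques → IsBiclique G S
      listed⇒biclique S∈ with ∈-tabulate⁻ S∈
      ... | i , refl = N[]-isBiclique (branching i)

      biclique⇒listed : ∀ {S} → IsBiclique G S → S ∈ₗ bicliques
      biclique⇒listed biclique with biclique⇒N[branching] biclique
      ... | c , br , refl with onto c br
      ...   | i , refl = ∈-tabulate⁺ i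

    noFalseTwins : (∀ {u v w} → ¬ Branching u → ¬ Branching v → Adj G u w → Adj G v w → u ≡ v) →
                   NoFalseTwins G
    noFalseTwins leaves-apart u v twins@(u≢v , same) with branching? u | branching? v
    ... | yes br | _      = branching⇒no-falseTwin br twins
    ... | no _   | yes br = branching⇒no-falseTwin br (falseTwins-sym twins)
    ... | no ¬bu | no ¬bv with has-neighbour u
    ...   | w , uw = u≢v (leaves-apart ¬bu ¬bv uw (Equivalence.to (same w) uw))

module Caterpillar (n k : ℕ) (2≤k : 2 ≤ k) (k+1<n : suc k < n) (n≤k+k : n ≤ k + k) where

  Parent : ℕ → ℕ → Set
  Parent a b = (suc a ≡ b × b ≤ suc k) ⊎ (k + a ≡ b × 2 ≤ a)

  Parent? : ∀ a b → Dec (Parent a b)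
  Parent? a b = (suc a ≟ b ×-dec b ≤? suc k) ⊎-dec (k + a ≟ b ×-dec 2 ≤? a)

  Edge : ℕ → ℕ → Set
  Edge a b = Parent a b ⊎ Parent b a

  Edge? : ∀ a b → Dec (Edge a b)
  Edge? a b = Parent? a b ⊎-dec Parent? b a

  parent<child : ∀ {a b} → Parent a b → a < b
  parent<child     (inj₁ (refl , _)) = ≤-refl
  parent<child {a} (inj₂ (refl , _)) = +-monoˡ-< a (≤-trans (s≤s z≤n) 2≤k)

  path<pendant : ∀ {a} → 2 ≤ a → suc k < k + a
  path<pendant {a} 2≤a = subst (_≤ k + a) (+-comm k 2) (+-monoʳ-≤ k 2≤a)

  no-pendant-beyond : ∀ {a} → k ≤ a → ¬ (k + a < n)
  no-pendant-beyond k≤a k+a<n = <-irrefl refl (≤-trans k+a<n (≤-trans n≤k+k (+-monoʳ-≤ k k≤a)))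

  parent-unique : ∀ {a b c} → Parent a c → Parent b c → a ≡ b
  parent-unique (inj₁ (refl , _))   (inj₁ (1+b≡1+a , _)) = sym (suc-injective 1+b≡1+a)
  parent-unique (inj₂ (refl , _))   (inj₂ (k+b≡k+a , _)) = sym (+-cancelˡ-≡ k _ _ k+b≡k+a)
  parent-unique (inj₁ (refl , c≤1+k)) (inj₂ (k+b≡c , 2≤b)) =
    ⊥-elim (<⇒≱ (path<pendant 2≤b) (subst (_≤ suc k) (sym k+b≡c) c≤1+k))
  parent-unique (inj₂ (refl , 2≤a)) (inj₁ (_ , c≤1+k)) =
    ⊥-elim (<⇒≱ (path<pendant 2≤a) c≤1+k)

  parent-exists : ∀ b → 0 < b → ∃ λ a → Parent a b
  parent-exists (suc a) _ with suc a ≤? suc k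
  ... | yes 1+a≤1+k = a , inj₁ (refl , 1+a≤1+k)
  ... | no  1+a≰1+k = suc a ∸ k , inj₂ (m+[n∸m]≡n (<⇒≤ k<1+a) , m+n≤o⇒m≤o∸n 2 (≰⇒> 1+a≰1+k))
    where
    k<1+a : k < suc a
    k<1+a = ≤-trans (n≤1+n (suc k)) (≰⇒> 1+a≰1+k)

  Internal : ℕ → Set
  Internal c = 1 ≤ c × c ≤ k

  Leaf : ℕ → Set
  Leaf c = c ≡ 0 ⊎ suc k ≤ c

  internal-or-leaf : ∀ c → Internal c ⊎ Leaf c
  internal-or-leaf zero = inj₂ (inj₁ refl)
  internal-or-leaf (suc c) with suc c ≤? k
  ... | yes 1+c≤k = inj₁ (s≤s z≤n , 1+c≤k)
  ... | no  1+c≰k = inj₂ (inj₂ (≰⇒> 1+c≰k))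

  LeafEdge : ℕ → ℕ → Set
  LeafEdge c p = (c ≡ 0 × p ≡ 1) ⊎ (suc k ≤ c × Parent p c)

  leafEdge : ∀ {c p} → Leaf c → Edge c p → p < n → LeafEdge c p
  leafEdge (inj₁ refl) (inj₁ (inj₁ (p≡1 , _)))  _   = inj₁ (refl , sym p≡1)
  leafEdge (inj₁ refl) (inj₁ (inj₂ (_ , ())))    _
  leafEdge (inj₁ refl) (inj₂ p→0)                _   = ⊥-elim (<⇒≱ (parent<child p→0) z≤n)
  leafEdge (inj₂ k<c)  (inj₁ (inj₁ (refl , c<1+k))) _ = ⊥-elim (<⇒≱ k<c (≤-pred c<1+k))
  leafEdge (inj₂ k<c)  (inj₁ (inj₂ (refl , _)))  p<n = ⊥-elim (no-pendant-beyond (<⇒≤ k<c) p<n)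
  leafEdge (inj₂ k<c)  (inj₂ p→c)                _   = inj₂ (k<c , p→c)

  leafEdge-functional : ∀ {c p q} → LeafEdge c p → LeafEdge c q → p ≡ q
  leafEdge-functional (inj₁ (_ , p≡1))  (inj₁ (_ , q≡1))  = trans p≡1 (sym q≡1)
  leafEdge-functional (inj₂ (_ , p→c))  (inj₂ (_ , q→c))  = parent-unique p→c q→c
  leafEdge-functional (inj₁ (refl , _)) (inj₂ (() , _))
  leafEdge-functional (inj₂ (() , _))   (inj₁ (refl , _))

  leafEdge-internal : ∀ {c p} → LeafEdge c p → c < n → Internal p
  leafEdge-internal (inj₁ (_ , refl)) _ = ≤-refl , ≤-trans (s≤s z≤n) 2≤k
  leafEdge-internal (inj₂ (k<c , inj₁ (refl , c≤1+k))) _ = ≤-trans (s≤s z≤n) (≤-trans 2≤k (≤-pred k<c)) , ≤-pred c≤1+k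
  leafEdge-internal (inj₂ (_ , inj₂ (refl , 2≤p))) k+p<n =
    ≤-trans (s≤s z≤n) 2≤p , <⇒≤ (+-cancelˡ-< k _ _ (≤-trans k+p<n n≤k+k))

  no-leaf-child-of-1 : ∀ {v} → suc k ≤ v → ¬ Parent 1 v
  no-leaf-child-of-1 k<v (inj₁ (refl , _))  = <⇒≱ (≤-trans (s≤s 2≤k) k<v) ≤-refl
  no-leaf-child-of-1 k<v (inj₂ (_ , s≤s ()))

  leaf-siblings-equal : ∀ {p u v} → Parent p u → Parent p v → suc k ≤ u → suc k ≤ v → u < n → v < n → u ≡ v
  leaf-siblings-equal (inj₁ (refl , _)) (inj₁ (refl , _)) _   _   _   _   = refl
  leaf-siblings-equal (inj₂ (refl , _)) (inj₂ (refl , _)) _   _   _   _   = refl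
  leaf-siblings-equal (inj₁ (refl , _)) (inj₂ (refl , _)) k<u _   _   v<n = ⊥-elim (no-pendant-beyond (≤-pred k<u) v<n)
  leaf-siblings-equal (inj₂ (refl , _)) (inj₁ (refl , _)) _   k<v u<n _   = ⊥-elim (no-pendant-beyond (≤-pred k<v) u<n)

  leafEdge-injective : ∀ {u v p} → LeafEdge u p → LeafEdge v p → u < n → v < n → u ≡ v
  leafEdge-injective (inj₁ (u≡0 , _))   (inj₁ (v≡0 , _))   _   _   = trans u≡0 (sym v≡0)
  leafEdge-injective (inj₁ (_ , refl))  (inj₂ (k<v , 1→v)) _   _   = ⊥-elim (no-leaf-child-of-1 k<v 1→v)
  leafEdge-injective (inj₂ (k<u , 1→u)) (inj₁ (_ , refl))  _   _   = ⊥-elim (no-leaf-child-of-1 k<u 1→u)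
  leafEdge-injective (inj₂ (k<u , p→u)) (inj₂ (k<v , p→v)) u<n v<n = leaf-siblings-equal p→u p→v k<u k<v u<n v<n

  caterpillar : Graph n
  caterpillar = record
    { adj    = λ u v → does (Edge? (toℕ u) (toℕ v))
    ; symm   = λ u v → does-⇔ (mk⇔ swap swap) (Edge? (toℕ u) (toℕ v)) (Edge? (toℕ v) (toℕ u))
    ; irrefl = λ u → dec-false (Edge? (toℕ u) (toℕ u)) (no-loop (toℕ u))
    }
    where
    no-loop : ∀ a → ¬ Edge a a
    no-loop a (inj₁ a→a) = <-irrefl refl (parent<child a→a)
    no-loop a (inj₂ a→a) = <-irrefl refl (parent<child a→a)

  open GraphProperties caterpillar

  Adj⇒Edge : ∀ {u v} → Adj caterpillar u v → Edge (toℕ u) (toℕ v)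
  Adj⇒Edge {u} {v} = does≡true⇒ (Edge? (toℕ u) (toℕ v))
    where
    does≡true⇒ : ∀ {A : Set} (a? : Dec A) → does a? ≡ true → A
    does≡true⇒ (yes a) _ = a

  Edge⇒Adj : ∀ {c a m} → toℕ c ≡ a → (m<n : m < n) → Edge a m → Adj caterpillar c (fromℕ< m<n)
  Edge⇒Adj c≡a m<n e = dec-true (Edge? _ _) (subst₂ Edge (sym c≡a) (sym (toℕ-fromℕ< m<n)) e)

  parent-vertex : ∀ v → 0 < toℕ v → ∃ (LowerNeighbour v)
  parent-vertex v 0<v with parent-exists (toℕ v) 0<v
  ... | a , a→v = fromℕ< a<n , Edge⇒Adj refl a<n (inj₂ a→v)
                , subst (_< toℕ v) (sym (toℕ-fromℕ< a<n)) (parent<child a→v)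
    where
    a<n : a < n
    a<n = <-trans (parent<child a→v) (toℕ<n v)

  lowerNeighbour⇒parent : ∀ {v u} → LowerNeighbour v u → Parent (toℕ u) (toℕ v)
  lowerNeighbour⇒parent (vu , u<v) with Adj⇒Edge vu
  ... | inj₁ v→u = ⊥-elim (<-asym u<v (parent<child v→u))
  ... | inj₂ u→v = u→v

  caterpillar-isTree : IsTree caterpillar
  caterpillar-isTree = connected-if-lowerNeighbours parent-vertex
    , UniqueLowerNeighbours.acyclic λ u↑v w↑v →
        toℕ-injective (parent-unique (lowerNeighbour⇒parent u↑v) (lowerNeighbour⇒parent w↑v))

  open Bicliques caterpillar (proj₂ caterpillar-isTree)

  internal⇒branching : ∀ c → Internal (toℕ c) → Branching c
  internal⇒branching c (1≤c , c≤k) = path-neighbours (toℕ c) refl 1≤c c≤k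
    where
    path-neighbours : ∀ a → toℕ c ≡ a → 1 ≤ a → a ≤ k → Branching c
    path-neighbours (suc m) c≡1+m _ 1+m≤k =
      fromℕ< 2+m<n , fromℕ< m<n
      , Edge⇒Adj c≡1+m 2+m<n (inj₁ (inj₁ (refl , s≤s 1+m≤k)))
      , Edge⇒Adj c≡1+m m<n (inj₂ (inj₁ (refl , m≤n⇒m≤1+n 1+m≤k)))
      , λ 2+m≡m → <-irrefl (sym (trans (sym (toℕ-fromℕ< 2+m<n)) (trans (cong toℕ 2+m≡m) (toℕ-fromℕ< m<n))))
                           (m<n⇒m<1+n (n<1+n m))
      where
      2+m<n : suc (suc m) < n
      2+m<n = ≤-trans (s≤s (s≤s 1+m≤k)) k+1<n
      m<n : m < n
      m<n = <-trans (n<1+n m) (subst (_< n) c≡1+m (toℕ<n c))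

  leafEdge-at : ∀ {c p} → Leaf (toℕ c) → Adj caterpillar c p → LeafEdge (toℕ c) (toℕ p)
  leafEdge-at {p = p} leaf cp = leafEdge leaf (Adj⇒Edge cp) (toℕ<n p)

  ¬branching⇒leaf : ∀ {c} → ¬ Branching c → Leaf (toℕ c)
  ¬branching⇒leaf {c} ¬br with internal-or-leaf (toℕ c)
  ... | inj₁ internal = ⊥-elim (¬br (internal⇒branching c internal))
  ... | inj₂ leaf     = leaf

  branching⇒internal : ∀ {c} → Branching c → Internal (toℕ c)
  branching⇒internal {c} (a , b , ca , cb , a≢b) with internal-or-leaf (toℕ c)
  ... | inj₁ internal = internal
  ... | inj₂ leaf     = ⊥-elim (a≢b (toℕ-injective (leafEdge-functional (leafEdge-at leaf ca) (leafEdge-at leaf cb))))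

  has-neighbour : ∀ c → ∃ (Adj caterpillar c)
  has-neighbour c with toℕ c ≟ 0
  ... | yes c≡0 = fromℕ< 1<n , Edge⇒Adj c≡0 1<n (inj₁ (inj₁ (refl , s≤s z≤n)))
    where
    1<n : 1 < n
    1<n = ≤-trans (s≤s (s≤s z≤n)) k+1<n
  ... | no c≢0 with parent-vertex c (n≢0⇒n>0 c≢0)
  ...   | p , cp , _ = p , cp

  open NoIsolatedVerticesOrEdges has-neighbour
         (λ {c} ¬br cp → internal⇒branching _
            (leafEdge-internal (leafEdge-at (¬branching⇒leaf ¬br) cp) (toℕ<n c)))

  internal-vertex : Fin k → Fin n
  internal-vertex i = fromℕ< (≤-trans (s≤s (toℕ<n i)) (<⇒≤ k+1<n))

  toℕ-internal-vertex : ∀ i → toℕ (internal-vertex i) ≡ suc (toℕ i)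
  toℕ-internal-vertex i = toℕ-fromℕ< _

  internal-vertex-onto : ∀ c → Internal (toℕ c) → ∃ λ i → internal-vertex i ≡ c
  internal-vertex-onto c (1≤c , c≤k) = index (toℕ c) refl 1≤c c≤k
    where
    index : ∀ a → toℕ c ≡ a → 1 ≤ a → a ≤ k → ∃ λ i → internal-vertex i ≡ c
    index (suc m) c≡1+m _ 1+m≤k = fromℕ< 1+m≤k
      , toℕ-injective (trans (toℕ-internal-vertex _) (trans (cong suc (toℕ-fromℕ< 1+m≤k)) (sym c≡1+m)))

  caterpillar-bicliques : HasExactlyBicliques caterpillar k
  caterpillar-bicliques = exactly-bicliques internal-vertex
    (λ same → toℕ-injective (suc-injective
      (trans (sym (toℕ-internal-vertex _)) (trans (cong toℕ same) (toℕ-internal-vertex _)))))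
    (λ i → internal⇒branching _ (subst Internal (sym (toℕ-internal-vertex i)) (s≤s z≤n , toℕ<n i)))
    (λ c br → internal-vertex-onto c (branching⇒internal br))

  caterpillar-noFalseTwins : NoFalseTwins caterpillar
  caterpillar-noFalseTwins = noFalseTwins λ {u} {v} {w} ¬bu ¬bv uw vw →
    toℕ-injective (leafEdge-injective (leafEdge-at {p = w} (¬branching⇒leaf ¬bu) uw) (leafEdge-at {p = w} (¬branching⇒leaf ¬bv) vw)
                                      (toℕ<n u) (toℕ<n v))

corollary3p6 : (n k : ℕ) → 4 ≤ n → ⌈ n /2⌉ ≤ k → k ≤ n ∸ 2 →
    Σ (Graph n) λ T → IsTree T × NoFalseTwins T × HasExactlyBicliques T k
corollary3p6 n k 4≤n ⌈n/2⌉≤k k≤n-2 =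
  caterpillar , caterpillar-isTree , caterpillar-noFalseTwins , caterpillar-bicliques
  where
  n≤k+k : n ≤ k + k
  n≤k+k = subst (_≤ k + k) (⌊n/2⌋+⌈n/2⌉≡n n) (+-mono-≤ (≤-trans (⌊n/2⌋≤⌈n/2⌉ n) ⌈n/2⌉≤k) ⌈n/2⌉≤k)

  2≤k : 2 ≤ k
  2≤k = half (≤-trans 4≤n n≤k+k)
    where
    half : ∀ {m} → 4 ≤ m + m → 2 ≤ m
    half {suc (suc _)} _ = s≤s (s≤s z≤n)
    half {suc zero} (s≤s (s≤s ()))

  k+1<n : suc k < n
  k+1<n = subst (_≤ n) (+-comm k 2) (m≤o∸n⇒m+n≤o k (≤-trans (s≤s (s≤s z≤n)) 4≤n) k≤n-2)

  open Caterpillar n k 2≤k k+1<n n≤k+k
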